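{- If $G$ is an $(X,Y)$-bigraph with no cycles, then $G$ has a path $X$-cover of size at most $\mathrm{def}_{\Lambda}(G)$.
   Context: An $(X,Y)$-bigraph is a bipartite graph with a specified ordered bipartition $(X,Y)$. A path $X$-cover of $G$ is a set of pairwise vertex-disjoint paths in $G$ that together cover all vertices of $X$. For $S \subseteq X$, $\Lambda(S)$ denotes the set of vertices in $Y$ having at least two neighbors in $S$. The $\Lambda$-deficiency of $S$ is $\mathrm{def}_{\Lambda}(G,S) = |S| - |\Lambda(S)|$, and $\mathrm{def}_{\Lambda}(G) = \max\{\mathrm{def}_{\Lambda}(G,S) : S \subseteq X\}$. -}

module Defs where

open import Data.Nat using (ℕ; zero; suc; _≤_)
open import Data.Bool using (Bool; true; false; _∧_)
open import Data.Fin using (Fin)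
open import Data.Fin.Subset using (Subset; ∣_∣)
open import Data.Vec using (Vec; []; _∷_; tabulate; lookup)
open import Data.Sum using (_⊎_; inj₁; inj₂)
open import Data.Empty using (⊥)
open import Data.List using (List; []; _∷_; _++_; [_]; length; map; concatMap; foldr)
open import Data.List.Relation.Unary.Unique.Propositional using (Unique)
open import Data.List.Relation.Unary.Linked using (Linked)
open import Data.List.Relation.Unary.AllPairs using (AllPairs)
open import Data.List.Relation.Binary.Disjoint.Propositional using (Disjoint)
open import Data.List.Membership.Propositional using (_∈_)
open import Data.List.Relation.Unary.Any using (Any)
open import Data.Integer using (ℤ; +_; _-_; _⊔_)
open import Data.Product using (Σ; _×_)
open import Relation.Binary.PropositionalEquality using (_≡_)

-- An (X,Y)-bigraph with X = Fin m, Y = Fin n (simple graph):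
-- E x y ≡ true iff x ∈ X and y ∈ Y are adjacent.
BiGraph : ℕ → ℕ → Set
BiGraph m n = Fin m → Fin n → Bool

V : ℕ → ℕ → Set
V m n = Fin m ⊎ Fin n

Adj : ∀ {m n} → BiGraph m n → V m n → V m n → Set
Adj G (inj₁ x) (inj₂ y) = G x y ≡ true
Adj G (inj₂ y) (inj₁ x) = G x y ≡ true
Adj G (inj₁ _) (inj₁ _) = ⊥
Adj G (inj₂ _) (inj₂ _) = ⊥

record IsPath {m n} (G : BiGraph m n) (p : List (V m n)) : Set where
  field
    nonempty : 1 ≤ length p
    distinct : Unique p
    linked   : Linked (Adj G) p

record IsCycle {m n} (G : BiGraph m n) (v : V m n) (vs : List (V m n)) : Set where
  field
    long     : 2 ≤ length vs
    distinct : Unique (v ∷ vs)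
    closed   : Linked (Adj G) (v ∷ vs ++ [ v ])

Acyclic : ∀ {m n} → BiGraph m n → Set
Acyclic {m} {n} G = ∀ (v : V m n) (vs : List (V m n)) → IsCycle G v vs → ⊥

record IsPathXCover {m n} (G : BiGraph m n) (P : List (List (V m n))) : Set where
  field
    paths    : ∀ p → p ∈ P → IsPath G p
    disjoint : AllPairs Disjoint P
    covers   : ∀ (x : Fin m) → Any (λ p → inj₁ x ∈ p) P

countNbrs : ∀ {m n} → BiGraph m n → Subset m → Fin n → ℕ
countNbrs G S y = ∣ tabulate (λ x → lookup S x ∧ G x y) ∣

atLeast2 : ℕ → Bool
atLeast2 (suc (suc _)) = true
atLeast2 _ = false

Λ : ∀ {m n} → BiGraph m n → Subset m → Subset n
Λ G S = tabulate (λ y → atLeast2 (countNbrs G S y))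

defΛS : ∀ {m n} → BiGraph m n → Subset m → ℤ
defΛS G S = + ∣ S ∣ - + ∣ Λ G S ∣

allSubsets : (m : ℕ) → List (Subset m)
allSubsets zero = [] ∷ []
allSubsets (suc m) = concatMap (λ S → (false ∷ S) ∷ (true ∷ S) ∷ []) (allSubsets m)

-- def_Λ(G) = max over S ⊆ X of def_Λ(G,S)
-- (fold starts at 0 = def_Λ(G,∅), which is among the values, so this is the max)
defΛ : ∀ {m n} → BiGraph m n → ℤ
defΛ {m} G = foldr (λ S d → defΛS G S ⊔ d) (+ 0) (allSubsets m)

-- Induction on the active part (A ⊆ X, B ⊆ Y) of the forest, maintaining a path cover P of A
-- inside the active vertices together with a witness S ⊆ A such that |P| + |Λ(S) ∩ B| ≤ |S|.
-- An endpoint of a longest active path exposes one of four local configurations: a vertex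
-- y ∈ B with at most one active neighbour (delete y), an isolated x (a one-vertex path,
-- and x joins S), two leaves x, x' hanging at the same y (the path x y x'; both join S and
-- only y can enter Λ), or a leaf x at a y whose only other active neighbour is x₀ (the path
-- x y x₀; x joins S and y, with a single neighbour left in S, stays out of Λ).
-- For A = X and B = Y the invariant reads |P| ≤ def_Λ(G, S) ≤ def_Λ(G).
module Submission where

open import Defs
open import Data.Nat using (zero; suc; _+_; _≤_; _<_; z≤n; s≤s)
open import Data.Nat.Properties
open import Data.Nat.Induction using (<-wellFounded)
open import Data.Bool using (Bool; true; false; _∧_)
open import Data.Bool.Properties using (∧-conicalˡ; ∧-conicalʳ) renaming (_≟_ to _≟ᵇ_)
open import Data.Fin using (Fin) renaming (_≟_ to _≟ᶠ_)
open import Data.Fin.Subset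
  using (Subset; inside; outside; _∈_; _∉_; _⊆_; _∩_; _∪_; _─_; _-_; ⁅_⁆; ⊥; ⊤; ∣_∣; Empty)
open import Data.Fin.Subset.Properties
  using (_∈?_; nonempty?; Empty-unique; ∣⊥∣≡0; ∉⊥; ⊥⊆; ∈⊤; x∈⁅x⁆; x∈⁅y⁆⇒x≡y; x∉⁅y⁆⇒x≢y; ∣⁅x⁆∣≡1;
         p⊆q⇒∣p∣≤∣q∣; p⊂q⇒∣p∣<∣q∣; x∈p∩q⁺; x∈p∩q⁻; x∈p∪q⁺; x∈p∪q⁻; p⊆p∪q; ∩-identityʳ;
         p─q⊆p; ∣p─q∣≤∣p∣; x∈p∧x≢y⇒x∈p-y; x∈p⇒∣p-x∣<∣p∣)
open import Data.Vec using ([]; _∷_; tabulate; lookup; there)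
open import Data.Vec.Properties using (lookup∘tabulate; []=⇒lookup; lookup⇒[]=)
open import Data.Sum using (_⊎_; inj₁; inj₂)
open import Data.Sum.Properties using (≡-dec; inj₁-injective; inj₂-injective)
open import Data.Maybe using (nothing; just)
open import Data.Maybe.Properties using (just-injective)
open import Data.Empty using (⊥-elim)
open import Function using (_∘_)
open import Data.Product using (Σ; ∃-syntax; _×_; _,_; proj₁)
open import Data.List using (List; []; _∷_; _++_; [_]; _∷ʳ_; length; map; allFin; head; concatMap; foldr)
open import Data.List.Properties using (length-++; length-map; length-tabulate; ++-assoc)
open import Data.List.Relation.Unary.All as All using (All; []; _∷_)
open import Data.List.Relation.Unary.All.Properties using (¬Any⇒All¬; ++⁻ˡ)
open import Data.List.Relation.Unary.Any using (Any; here; there; any?; satisfied)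
open import Data.List.Relation.Unary.AllPairs using (AllPairs; []; _∷_)
open import Data.List.Relation.Unary.Linked as Linked using (Linked; []; [-]; _∷_)
open import Data.List.Relation.Unary.Unique.Propositional using (Unique)
open import Data.List.Membership.Propositional using (lose) renaming (_∈_ to _∈ˡ_; _∉_ to _∉ˡ_)
open import Data.List.Membership.Propositional.Properties
  using (∈-∃++; ∈-++⁺ˡ; ∈-++⁺ʳ; ∈-++⁻; ∈-map⁺; ∈-allFin)
open import Data.Integer using (ℤ; +_; +≤+; _⊔_) renaming (_≤_ to _≤ᶻ_; _-_ to _-ᶻ_)
open import Data.Integer.Properties using ([+m]-[+n]≡m⊖n; ⊖-≥; i≤i⊔j; i≤j⊔i) renaming (≤-trans to ≤ᶻ-trans)
open import Induction.WellFounded using (Acc; acc)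
open import Algebra.Properties.CommutativeSemigroup +-commutativeSemigroup using (x∙yz≈y∙xz)
open import Data.List.Relation.Binary.Disjoint.Propositional using (Disjoint)
import Data.List.Membership.DecPropositional as DecMembership
open import Relation.Binary.PropositionalEquality using (_≡_; _≢_; refl; sym; trans; cong; cong₂; subst; module ≡-Reasoning)
open import Relation.Nullary using (¬_; Dec; yes; no)
open import Relation.Nullary.Decidable using (_×-dec_; ¬?; decidable-stable)

module _ {a r} {A : Set a} {R : A → A → Set r} where

  AllPairs-++⁻ˡ : ∀ xs {ys} → AllPairs R (xs ++ ys) → AllPairs R xs
  AllPairs-++⁻ˡ []       _          = []
  AllPairs-++⁻ˡ (x ∷ xs) (px ∷ pxs) = ++⁻ˡ xs px ∷ AllPairs-++⁻ˡ xs pxs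

  Linked-++⁻ˡ : ∀ xs {ys} → Linked R (xs ++ ys) → Linked R xs
  Linked-++⁻ˡ []           _       = []
  Linked-++⁻ˡ (x ∷ [])     _       = [-]
  Linked-++⁻ˡ (x ∷ y ∷ xs) (r ∷ l) = r ∷ Linked-++⁻ˡ (y ∷ xs) l

  Linked-∷ʳ⁺ : ∀ xs {x y} → Linked R (xs ∷ʳ x) → R x y → Linked R (xs ∷ʳ x ∷ʳ y)
  Linked-∷ʳ⁺ []           _            rxy = rxy ∷ [-]
  Linked-∷ʳ⁺ (z ∷ [])     (rzx ∷ [-])  rxy = rzx ∷ rxy ∷ [-]
  Linked-∷ʳ⁺ (z ∷ w ∷ xs) (rzw ∷ l)    rxy = rzw ∷ Linked-∷ʳ⁺ (w ∷ xs) l rxy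

module _ {a} {A : Set a} where

  length-++-∷ : ∀ (xs : List A) {x ys} → length (xs ++ x ∷ ys) ≡ suc (length (xs ++ ys))
  length-++-∷ xs {x} {ys} = begin
    length (xs ++ x ∷ ys)       ≡⟨ length-++ xs ⟩
    length xs + suc (length ys) ≡⟨ +-suc (length xs) (length ys) ⟩
    suc (length xs + length ys) ≡⟨ cong suc (length-++ xs) ⟨
    suc (length (xs ++ ys))     ∎
    where open ≡-Reasoning

  Unique⇒length≤ : ∀ {xs ys : List A} → Unique xs → (∀ {z} → z ∈ˡ xs → z ∈ˡ ys) → length xs ≤ length ys
  Unique⇒length≤ {[]}     _              _  = z≤n
  Unique⇒length≤ {x ∷ xs} (x∉xs ∷ uniq) xs⊆ys with ∈-∃++ (xs⊆ys (here refl))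
  ... | ys₁ , ys₂ , refl = subst (suc (length xs) ≤_) (sym (length-++-∷ ys₁))
          (s≤s (Unique⇒length≤ uniq (λ z∈xs → drop-x (xs⊆ys (there z∈xs)) (All.lookup x∉xs z∈xs))))
    where
    drop-x : ∀ {z} → z ∈ˡ ys₁ ++ x ∷ ys₂ → x ≢ z → z ∈ˡ ys₁ ++ ys₂
    drop-x z∈ x≢z with ∈-++⁻ ys₁ z∈
    ... | inj₁ z∈ys₁           = ∈-++⁺ˡ z∈ys₁
    ... | inj₂ (here refl)     = ⊥-elim (x≢z refl)
    ... | inj₂ (there z∈ys₂)   = ∈-++⁺ʳ ys₁ z∈ys₂

x∈p─q⇒x∉q : ∀ {n} {x : Fin n} (p q : Subset n) → x ∈ p ─ q → x ∉ q
x∈p─q⇒x∉q (_ ∷ p) (outside ∷ q) (there x∈p─q) (there x∈q) = x∈p─q⇒x∉q p q x∈p─q x∈q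
x∈p─q⇒x∉q (_ ∷ p) (inside  ∷ q) (there x∈p─q) (there x∈q) = x∈p─q⇒x∉q p q x∈p─q x∈q

module _ {n} {p : Subset n} where

  x∈p-y⇒x≢y : ∀ {x y} → x ∈ p - y → x ≢ y
  x∈p-y⇒x≢y {y = y} x∈p-y = x∉⁅y⁆⇒x≢y (x∈p─q⇒x∉q p ⁅ y ⁆ x∈p-y)

  x∉p-x : ∀ {x} → x ∉ p - x
  x∉p-x x∈p-x = x∈p-y⇒x≢y x∈p-x refl

  p-x-y⊆p : ∀ {x y} → p - x - y ⊆ p
  p-x-y⊆p {x} {y} = p─q⊆p p ⁅ x ⁆ ∘ p─q⊆p (p - x) ⁅ y ⁆

  x∈p∧x∉p-y⇒x≡y : ∀ {x y} → x ∈ p → x ∉ p - y → x ≡ y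
  x∈p∧x∉p-y⇒x≡y {x} {y} x∈p x∉p-y with x ≟ᶠ y
  ... | yes x≡y = x≡y
  ... | no  x≢y = ⊥-elim (x∉p-y (x∈p∧x≢y⇒x∈p-y x∈p x≢y))

  p∪⁅x⁆⊆q : ∀ {q : Subset n} {x} → p ⊆ q → x ∈ q → p ∪ ⁅ x ⁆ ⊆ q
  p∪⁅x⁆⊆q {x = x} p⊆q x∈q z∈ with x∈p∪q⁻ p ⁅ x ⁆ z∈
  ... | inj₁ z∈p   = p⊆q z∈p
  ... | inj₂ z∈⁅x⁆ = subst (_∈ _) (sym (x∈⁅y⁆⇒x≡y x z∈⁅x⁆)) x∈q

  x∉p⇒∣p∣<∣p∪⁅x⁆∣ : ∀ {x} → x ∉ p → ∣ p ∣ < ∣ p ∪ ⁅ x ⁆ ∣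
  x∉p⇒∣p∣<∣p∪⁅x⁆∣ {x} x∉p = p⊂q⇒∣p∣<∣q∣ (p⊆p∪q ⁅ x ⁆ , x , x∈p∪q⁺ (inj₂ (x∈⁅x⁆ x)) , x∉p)

  ∣p∣≤1 : (∀ {x y} → x ∈ p → y ∈ p → x ≡ y) → ∣ p ∣ ≤ 1
  ∣p∣≤1 all-equal with nonempty? p
  ... | yes (x , x∈p) = subst (∣ p ∣ ≤_) (∣⁅x⁆∣≡1 x)
                          (p⊆q⇒∣p∣≤∣q∣ (λ y∈p → subst (_∈ ⁅ x ⁆) (all-equal x∈p y∈p) (x∈⁅x⁆ x)))
  ... | no  empty     = subst (_≤ 1) (sym (trans (cong ∣_∣ (Empty-unique empty)) (∣⊥∣≡0 n))) z≤n

∩⊆∩ : ∀ {n} {p q p' q' : Subset n} → (∀ {x} → x ∈ p → x ∈ q → x ∈ p' × x ∈ q') → p ∩ q ⊆ p' ∩ q'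
∩⊆∩ {p = p} {q} both x∈p∩q with x∈p∩q⁻ p q x∈p∩q
... | x∈p , x∈q = x∈p∩q⁺ (both x∈p x∈q)

∣p∪q∣≤∣p∣+∣q∣ : ∀ {n} (p q : Subset n) → ∣ p ∪ q ∣ ≤ ∣ p ∣ + ∣ q ∣
∣p∪q∣≤∣p∣+∣q∣ []            []            = z≤n
∣p∪q∣≤∣p∣+∣q∣ (outside ∷ p) (outside ∷ q) = ∣p∪q∣≤∣p∣+∣q∣ p q
∣p∪q∣≤∣p∣+∣q∣ (outside ∷ p) (inside  ∷ q) =
  subst (suc ∣ p ∪ q ∣ ≤_) (sym (+-suc ∣ p ∣ ∣ q ∣)) (s≤s (∣p∪q∣≤∣p∣+∣q∣ p q))
∣p∪q∣≤∣p∣+∣q∣ (inside  ∷ p) (outside ∷ q) = s≤s (∣p∪q∣≤∣p∣+∣q∣ p q)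
∣p∪q∣≤∣p∣+∣q∣ (inside  ∷ p) (inside  ∷ q) = s≤s (≤-trans (∣p∪q∣≤∣p∣+∣q∣ p q) (+-monoʳ-≤ ∣ p ∣ (n≤1+n ∣ q ∣)))

∈-tabulate⁺ : ∀ {n} {f : Fin n → Bool} {x} → f x ≡ true → x ∈ tabulate f
∈-tabulate⁺ {f = f} {x} fx = lookup⇒[]= x (tabulate f) (trans (lookup∘tabulate f x) fx)

∈-tabulate⁻ : ∀ {n} {f : Fin n → Bool} {x} → x ∈ tabulate f → f x ≡ true
∈-tabulate⁻ {f = f} {x} x∈ = trans (sym (lookup∘tabulate f x)) ([]=⇒lookup x∈)

bound-∷ : ∀ {p l l' s s'} k → p + l' ≤ s' → l ≤ k + l' → k + s' < s → suc p + l ≤ s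
bound-∷ {p} {l} {l'} {s} {s'} k p+l'≤s' l≤k+l' k+s'<s = begin
  suc p + l          ≤⟨ +-monoʳ-≤ (suc p) l≤k+l' ⟩
  suc (p + (k + l')) ≡⟨ cong suc (x∙yz≈y∙xz p k l') ⟩
  suc (k + (p + l')) ≤⟨ s≤s (+-monoʳ-≤ k p+l'≤s') ⟩
  suc (k + s')       ≤⟨ k+s'<s ⟩
  s                  ∎
  where open ≤-Reasoning

module _ {m n} (G : BiGraph m n) where

  nbrsIn : Subset m → Fin n → Subset m
  nbrsIn S y = tabulate (λ x → lookup S x ∧ G x y)

  ∈nbrsIn⁺ : ∀ {S x y} → x ∈ S → G x y ≡ true → x ∈ nbrsIn S y
  ∈nbrsIn⁺ x∈S gxy = ∈-tabulate⁺ (cong₂ _∧_ ([]=⇒lookup x∈S) gxy)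

  ∈nbrsIn⁻ : ∀ {S x y} → x ∈ nbrsIn S y → x ∈ S × G x y ≡ true
  ∈nbrsIn⁻ {S} {x} x∈ = lookup⇒[]= x S (∧-conicalˡ _ _ Sx∧gxy) , ∧-conicalʳ _ _ Sx∧gxy
    where Sx∧gxy = ∈-tabulate⁻ x∈

  ∈Λ⁺ : ∀ {S y} → 2 ≤ ∣ nbrsIn S y ∣ → y ∈ Λ G S
  ∈Λ⁺ {S} {y} 2≤ = ∈-tabulate⁺ (atLeast2⁺ 2≤)
    where
    atLeast2⁺ : ∀ {c} → 2 ≤ c → atLeast2 c ≡ true
    atLeast2⁺ (s≤s (s≤s _)) = refl

  ∈Λ⁻ : ∀ {S y} → y ∈ Λ G S → 2 ≤ ∣ nbrsIn S y ∣
  ∈Λ⁻ y∈ = atLeast2⁻ _ (∈-tabulate⁻ y∈)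
    where
    atLeast2⁻ : ∀ c → atLeast2 c ≡ true → 2 ≤ c
    atLeast2⁻ (suc (suc _)) _ = s≤s (s≤s z≤n)

  ∈Λ-mono : ∀ {S S' y} → (∀ {x} → x ∈ S → G x y ≡ true → x ∈ S') → y ∈ Λ G S → y ∈ Λ G S'
  ∈Λ-mono {S} {S'} S⊆S' y∈Λ = ∈Λ⁺ {S'} (≤-trans (∈Λ⁻ {S} y∈Λ) (p⊆q⇒∣p∣≤∣q∣ λ x∈ →
    let x∈S , gxy = ∈nbrsIn⁻ {S} x∈ in ∈nbrsIn⁺ {S'} (S⊆S' x∈S gxy) gxy))

  ∉Λ : ∀ {S y} → (∀ {x x'} → x ∈ S → x' ∈ S → G x y ≡ true → G x' y ≡ true → x ≡ x') → y ∉ Λ G S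
  ∉Λ {S} unique y∈Λ = ≤⇒≯ (∣p∣≤1 λ x∈ x'∈ →
    let x∈S , gxy = ∈nbrsIn⁻ {S} x∈ ; x'∈S , gx'y = ∈nbrsIn⁻ {S} x'∈ in unique x∈S x'∈S gxy gx'y) (∈Λ⁻ {S} y∈Λ)

  ∈Λ-∪⁅⁆⁻ : ∀ {S x y} → G x y ≢ true → y ∈ Λ G (S ∪ ⁅ x ⁆) → y ∈ Λ G S
  ∈Λ-∪⁅⁆⁻ {S} {x} {y} ¬gxy = ∈Λ-mono λ {z} z∈ gzy → case (x∈p∪q⁻ S ⁅ x ⁆ z∈) gzy
    where
    case : ∀ {z} → z ∈ S ⊎ z ∈ ⁅ x ⁆ → G z y ≡ true → z ∈ S
    case (inj₁ z∈S)   _   = z∈S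
    case (inj₂ z∈⁅x⁆) gzy = ⊥-elim (¬gxy (subst (λ z → G z y ≡ true) (x∈⁅y⁆⇒x≡y x z∈⁅x⁆) gzy))

  Adj-irrefl : ∀ {v} → ¬ Adj G v v
  Adj-irrefl {inj₁ _} ()
  Adj-irrefl {inj₂ _} ()

  adj? : ∀ u v → Dec (Adj G u v)
  adj? (inj₁ x) (inj₂ y) = G x y ≟ᵇ true
  adj? (inj₂ y) (inj₁ x) = G x y ≟ᵇ true
  adj? (inj₁ _) (inj₁ _) = no λ ()
  adj? (inj₂ _) (inj₂ _) = no λ ()

  Active : Subset m → Subset n → V m n → Set
  Active A B (inj₁ x) = x ∈ A
  Active A B (inj₂ y) = y ∈ B

  active? : ∀ A B v → Dec (Active A B v)
  active? A B (inj₁ x) = x ∈? A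
  active? A B (inj₂ y) = y ∈? B

  Active-mono : ∀ {A A' B B'} → A' ⊆ A → B' ⊆ B → ∀ {v} → Active A' B' v → Active A B v
  Active-mono A'⊆A _ {inj₁ _} = A'⊆A
  Active-mono _ B'⊆B {inj₂ _} = B'⊆B

  allV : List (V m n)
  allV = map inj₁ (allFin m) ++ map inj₂ (allFin n)

  ∈-allV : ∀ v → v ∈ˡ allV
  ∈-allV (inj₁ x) = ∈-++⁺ˡ (∈-map⁺ inj₁ (∈-allFin x))
  ∈-allV (inj₂ y) = ∈-++⁺ʳ (map inj₁ (allFin m)) (∈-map⁺ inj₂ (∈-allFin y))

  length-allV : length allV ≡ m + n
  length-allV = trans (length-++ (map inj₁ (allFin m)))
    (cong₂ _+_ (trans (length-map inj₁ (allFin m)) (length-tabulate {n = m} (λ i → i)))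
               (trans (length-map inj₂ (allFin n)) (length-tabulate {n = n} (λ i → i))))

  Unique⇒length≤m+n : ∀ {p} → Unique p → length p ≤ m + n
  Unique⇒length≤m+n {p} uniq = subst (length p ≤_) length-allV (Unique⇒length≤ uniq (λ {v} _ → ∈-allV v))

  open DecMembership {A = V m n} (≡-dec _≟ᶠ_ _≟ᶠ_) using () renaming (_∈?_ to _∈ˡ?_)

  trivialPath : ∀ x → IsPath G [ inj₁ x ]
  trivialPath x = record { nonempty = s≤s z≤n ; distinct = [] ∷ [] ; linked = [-] }

  cherry : ∀ {x x' y} → x ≢ x' → G x y ≡ true → G x' y ≡ true → IsPath G (inj₁ x ∷ inj₂ y ∷ inj₁ x' ∷ [])
  cherry x≢x' gxy gx'y = record
    { nonempty = s≤s z≤n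
    ; distinct = ((λ ()) ∷ x≢x' ∘ inj₁-injective ∷ []) ∷ ((λ ()) ∷ []) ∷ [] ∷ []
    ; linked   = gxy ∷ gx'y ∷ [-]
    }

  record Cover (A : Subset m) (B : Subset n) (P : List (List (V m n))) : Set where
    field
      paths    : ∀ p → p ∈ˡ P → IsPath G p
      active   : ∀ {p} → p ∈ˡ P → All (Active A B) p
      disjoint : AllPairs Disjoint P
      covers   : ∀ {x} → x ∈ A → Any (inj₁ x ∈ˡ_) P

  Cover-weaken : ∀ {A B B' P} → B' ⊆ B → Cover A B' P → Cover A B P
  Cover-weaken B'⊆B cover = record
    { paths    = paths
    ; active   = All.map (Active-mono (λ x∈A → x∈A) B'⊆B) ∘ active
    ; disjoint = disjoint
    ; covers   = covers
    }
    where open Cover cover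

  Cover-∷ : ∀ {A A' B B' q P} → A' ⊆ A → B' ⊆ B → IsPath G q → All (Active A B) q →
            All (¬_ ∘ Active A' B') q → (∀ {x} → x ∈ A → x ∉ A' → inj₁ x ∈ˡ q) →
            Cover A' B' P → Cover A B (q ∷ P)
  Cover-∷ {A' = A'} {q = q} {P} A'⊆A B'⊆B q-path q-active q-fresh q-covers cover = record
    { paths    = λ { _ (here refl) → q-path ; p (there p∈P) → paths p p∈P }
    ; active   = λ { (here refl) → q-active ; (there p∈P) → All.map (Active-mono A'⊆A B'⊆B) (active p∈P) }
    ; disjoint = All.tabulate (λ p∈P (v∈q , v∈p) → All.lookup q-fresh v∈q (All.lookup (active p∈P) v∈p)) ∷ disjoint
    ; covers   = covers′
    }
    where
    open Cover cover
    covers′ : ∀ {x} → x ∈ _ → Any (inj₁ x ∈ˡ_) (q ∷ P)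
    covers′ {x} x∈A with x ∈? A'
    ... | yes x∈A' = there (covers x∈A')
    ... | no  x∉A' = here (q-covers x∈A x∉A')

  Cover-isolated : ∀ {A B P x} → x ∈ A → Cover (A - x) B P → Cover A B ([ inj₁ x ] ∷ P)
  Cover-isolated {A} {x = x} x∈A = Cover-∷ (p─q⊆p A ⁅ x ⁆) (λ y∈B → y∈B) (trivialPath x) (x∈A ∷ []) (x∉p-x ∷ [])
    λ x'∈A x'∉A-x → here (cong inj₁ (x∈p∧x∉p-y⇒x≡y x'∈A x'∉A-x))

  Cover-cherry : ∀ {A B P x x' y} → x ∈ A → x' ∈ A → y ∈ B → x ≢ x' → G x y ≡ true → G x' y ≡ true →
                 Cover (A - x - x') (B - y) P → Cover A B ((inj₁ x ∷ inj₂ y ∷ inj₁ x' ∷ []) ∷ P)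
  Cover-cherry {A} {B} {x = x} {x'} {y} x∈A x'∈A y∈B x≢x' gxy gx'y = Cover-∷ p-x-y⊆p (p─q⊆p B ⁅ y ⁆)
    (cherry x≢x' gxy gx'y) (x∈A ∷ y∈B ∷ x'∈A ∷ []) (x∉p-x ∘ p─q⊆p (A - x) ⁅ x' ⁆ ∷ x∉p-x ∷ x∉p-x ∷ []) x-or-x'
    where
    x-or-x' : ∀ {z} → z ∈ A → z ∉ A - x - x' → inj₁ z ∈ˡ inj₁ x ∷ inj₂ y ∷ inj₁ x' ∷ []
    x-or-x' {z} z∈A z∉ with z ≟ᶠ x'
    ... | yes z≡x' = there (there (here (cong inj₁ z≡x')))
    ... | no  z≢x' = here (cong inj₁ (x∈p∧x∉p-y⇒x≡y z∈A λ z∈A-x → z∉ (x∈p∧x≢y⇒x∈p-y z∈A-x z≢x')))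

  record BoundedCover (A : Subset m) (B : Subset n) : Set where
    field
      P     : List (List (V m n))
      S     : Subset m
      cover : Cover A B P
      S⊆A   : S ⊆ A
      bound : length P + ∣ Λ G S ∩ B ∣ ≤ ∣ S ∣

  emptyCover : ∀ {A B} → Empty A → BoundedCover A B
  emptyCover {B = B} A-empty = record
    { P     = []
    ; S     = ⊥
    ; cover = record
      { paths = λ _ () ; active = λ () ; disjoint = [] ; covers = λ x∈A → ⊥-elim (A-empty (_ , x∈A)) }
    ; S⊆A   = ⊥⊆
    ; bound = ≤-trans (p⊆q⇒∣p∣≤∣q∣ {q = ⊥} λ y∈ → ⊥-elim (∉Λ {⊥} (⊥-elim ∘ ∉⊥) (proj₁ (x∈p∩q⁻ (Λ G ⊥) B y∈))))
                      (≤-reflexive (trans (∣⊥∣≡0 n) (sym (∣⊥∣≡0 m))))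
    }

  module _ (acyclic : Acyclic G) where

    no-chord : ∀ {a b r u} → Unique (a ∷ b ∷ r) → Linked (Adj G) (a ∷ b ∷ r) → u ∈ˡ r → ¬ Adj G u a
    no-chord {a} {b} {u = u} uniq linked u∈r adj with ∈-∃++ u∈r
    ... | r₁ , r₂ , refl = acyclic a (b ∷ r₁ ∷ʳ u) record
      { long     = s≤s (subst (1 ≤_) (sym (length-++ r₁)) (m≤n+m 1 (length r₁)))
      ; distinct = AllPairs-++⁻ˡ (a ∷ b ∷ r₁ ∷ʳ u) (subst Unique split uniq)
      ; closed   = Linked-∷ʳ⁺ (a ∷ b ∷ r₁) (Linked-++⁻ˡ (a ∷ b ∷ r₁ ∷ʳ u) (subst (Linked (Adj G)) split linked)) adj
      }
      where
      split : a ∷ b ∷ r₁ ++ u ∷ r₂ ≡ (a ∷ b ∷ r₁ ∷ʳ u) ++ r₂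
      split = cong (λ r → a ∷ b ∷ r) (sym (++-assoc r₁ [ u ] r₂))

    adjacent-on-path⇒next : ∀ {a r t} → Unique (a ∷ r) → Linked (Adj G) (a ∷ r) → t ∈ˡ r → Adj G t a →
                            head r ≡ just t
    adjacent-on-path⇒next _    _      (here refl)  _   = refl
    adjacent-on-path⇒next uniq linked (there t∈r) adj = ⊥-elim (no-chord uniq linked t∈r adj)

    module _ (A : Subset m) (B : Subset n) where

      Leaf : Fin m → Fin n → Set
      Leaf x y = ∀ {y'} → y' ∈ B → G x y' ≡ true → y' ≡ y

      data Reducible : Set where
        lonely     : ∀ {y} → y ∈ B →
                     (∀ {x x'} → x ∈ A → x' ∈ A → G x y ≡ true → G x' y ≡ true → x ≡ x') → Reducible
        isolated   : ∀ {x} → x ∈ A → (∀ {y} → y ∈ B → G x y ≢ true) → Reducible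
        twinLeaves : ∀ {x x' y} → x ∈ A → x' ∈ A → y ∈ B → x ≢ x' → G x y ≡ true → G x' y ≡ true →
                     Leaf x y → Leaf x' y → Reducible
        pendant    : ∀ {x x₀ y} → x ∈ A → x₀ ∈ A → y ∈ B → x ≢ x₀ → G x y ≡ true → G x₀ y ≡ true →
                     Leaf x y → (∀ {x'} → x' ∈ A → G x' y ≡ true → x' ≡ x ⊎ x' ≡ x₀) → Reducible

      record ActivePath (p : List (V m n)) : Set where
        field
          distinct : Unique p
          linked   : Linked (Adj G) p
          active   : All (Active A B) p

      open ActivePath

      ActivePath-tail : ∀ {v r} → ActivePath (v ∷ r) → ActivePath r
      ActivePath-tail record { distinct = _ ∷ uniq ; linked = linked ; active = _ ∷ act } =
        record { distinct = uniq ; linked = Linked.tail linked ; active = act }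

      ActivePath-∷ : ∀ {u v r} → ActivePath (v ∷ r) → Active A B u → Adj G u v → u ∉ˡ v ∷ r →
                     ActivePath (u ∷ v ∷ r)
      ActivePath-∷ ap au adj u∉ = record
        { distinct = ¬Any⇒All¬ _ u∉ ∷ distinct ap ; linked = adj ∷ linked ap ; active = au ∷ active ap }

      Longer : List (V m n) → Set
      Longer p = ∃[ v ] ∃[ r ] ActivePath (v ∷ r) × length p < length (v ∷ r)

      Stuck : List (V m n) → V m n → Set
      Stuck p v = ∀ {u} → Active A B u → Adj G u v → u ∈ˡ p

      exit-or-stuck : ∀ p v → (∃[ u ] Active A B u × Adj G u v × u ∉ˡ p) ⊎ Stuck p v
      exit-or-stuck p v with any? (λ u → active? A B u ×-dec adj? u v ×-dec ¬? (u ∈ˡ? p)) allV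
      ... | yes exit = inj₁ (satisfied exit)
      ... | no ¬exit = inj₂ λ {u} au adj →
              decidable-stable (u ∈ˡ? p) λ u∉p → ¬exit (lose (∈-allV u) (au , adj , u∉p))

      stuck⇒next : ∀ {v r u} → ActivePath (v ∷ r) → Stuck (v ∷ r) v → Active A B u → Adj G u v →
                   head r ≡ just u
      stuck⇒next ap stuck au adj with stuck au adj
      ... | here refl = ⊥-elim (Adj-irrefl adj)
      ... | there u∈r = adjacent-on-path⇒next (distinct ap) (linked ap) u∈r adj

      stuck⇒prev-or-next : ∀ {v w r u} → ActivePath (v ∷ w ∷ r) → Stuck (v ∷ w ∷ r) w →
                           Active A B u → Adj G u w → u ≡ v ⊎ head r ≡ just u
      stuck⇒prev-or-next ap stuck au adj with stuck au adj
      ... | here u≡v          = inj₁ u≡v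
      ... | there (here refl) = ⊥-elim (Adj-irrefl adj)
      ... | there (there u∈r) = inj₂ (adjacent-on-path⇒next (distinct ap′) (linked ap′) u∈r adj)
        where ap′ = ActivePath-tail ap

      stuck⇒Leaf : ∀ {x y r} → ActivePath (inj₁ x ∷ inj₂ y ∷ r) → Stuck (inj₁ x ∷ inj₂ y ∷ r) (inj₁ x) →
                   Leaf x y
      stuck⇒Leaf ap stuck y'∈B gxy' = sym (inj₂-injective (just-injective (stuck⇒next ap stuck y'∈B gxy')))

      parent-stuck : ∀ {x y} r → ActivePath (inj₁ x ∷ inj₂ y ∷ r) → Leaf x y →
                     Stuck (inj₁ x ∷ inj₂ y ∷ r) (inj₂ y) → Reducible
      parent-stuck {x} {y} [] ap _ stuck =
        lonely (All.head (All.tail (active ap))) λ x₁∈A x₂∈A g₁ g₂ → trans (is-x x₁∈A g₁) (sym (is-x x₂∈A g₂))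
        where
        is-x : ∀ {x'} → x' ∈ A → G x' y ≡ true → x' ≡ x
        is-x x'∈A g with stuck⇒prev-or-next ap stuck x'∈A g
        ... | inj₁ x'≡x = inj₁-injective x'≡x
      parent-stuck {x} {y} (inj₁ x₀ ∷ _)
        ap@record { distinct = (_ ∷ x≢x₀ ∷ _) ∷ _ ; linked = gxy ∷ gx₀y ∷ _ ; active = x∈A ∷ y∈B ∷ x₀∈A ∷ _ }
        leaf stuck = pendant x∈A x₀∈A y∈B (x≢x₀ ∘ cong inj₁) gxy gx₀y leaf x-or-x₀
        where
        x-or-x₀ : ∀ {x'} → x' ∈ A → G x' y ≡ true → x' ≡ x ⊎ x' ≡ x₀
        x-or-x₀ x'∈A g with stuck⇒prev-or-next ap stuck x'∈A g
        ... | inj₁ x'≡x    = inj₁ (inj₁-injective x'≡x)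
        ... | inj₂ next≡x' = inj₂ (sym (inj₁-injective (just-injective next≡x')))
      parent-stuck (inj₂ _ ∷ _) record { linked = _ ∷ () ∷ _ } _ _

      module _ {x y r} (ap : ActivePath (inj₁ x ∷ inj₂ y ∷ r)) (leaf : Leaf x y) where

        private
          x∈A : x ∈ A
          x∈A = All.head (active ap)

          y∈B : y ∈ B
          y∈B = All.head (All.tail (active ap))

          gxy : G x y ≡ true
          gxy = Linked.head (linked ap)

        -- Once w has a further neighbour, the path through w is longer than the one through x.
        sibling : ∀ {w} → ActivePath (inj₁ w ∷ inj₂ y ∷ r) → w ≢ x → Reducible ⊎ Longer (inj₁ x ∷ inj₂ y ∷ r)
        sibling {w} ap′ w≢x with exit-or-stuck (inj₁ w ∷ inj₂ y ∷ r) (inj₁ w)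
        ... | inj₁ (u , au , adj , u∉) = inj₂ (u , _ , ActivePath-∷ ap′ au adj u∉ , ≤-refl)
        ... | inj₂ stuck = inj₁ (twinLeaves x∈A (All.head (active ap′)) y∈B (w≢x ∘ sym) gxy
                                            (Linked.head (linked ap′)) leaf (stuck⇒Leaf ap′ stuck))

        at-leaf : Reducible ⊎ Longer (inj₁ x ∷ inj₂ y ∷ r)
        at-leaf with exit-or-stuck (inj₁ x ∷ inj₂ y ∷ r) (inj₂ y)
        ... | inj₁ (inj₁ w , w∈A , gwy , w∉) =
                sibling (ActivePath-∷ (ActivePath-tail ap) w∈A gwy (w∉ ∘ there)) (w∉ ∘ here ∘ cong inj₁)
        ... | inj₂ stuck = inj₁ (parent-stuck r ap leaf stuck)

      advance : ∀ {v r} → ActivePath (v ∷ r) → Reducible ⊎ Longer (v ∷ r)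
      advance {v} {r} ap with exit-or-stuck (v ∷ r) v
      ... | inj₁ (u , au , adj , u∉) = inj₂ (u , v ∷ r , ActivePath-∷ ap au adj u∉ , ≤-refl)
      ... | inj₂ stuck = at-end v r ap stuck
        where
        at-end : ∀ v r → ActivePath (v ∷ r) → Stuck (v ∷ r) v → Reducible ⊎ Longer (v ∷ r)
        at-end (inj₂ _) r ap stuck = inj₁ (lonely (All.head (active ap)) λ x∈A x'∈A gxy gx'y →
          inj₁-injective (just-injective (trans (sym (stuck⇒next ap stuck x∈A gxy)) (stuck⇒next ap stuck x'∈A gx'y))))
        at-end (inj₁ _) [] ap stuck = inj₁ (isolated (All.head (active ap)) λ y∈B gxy →
          nothing≢just (stuck⇒next {u = inj₂ _} ap stuck y∈B gxy))
          where
          nothing≢just : ∀ {t : V m n} → nothing ≢ just t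
          nothing≢just ()
        at-end (inj₁ _) (inj₂ _ ∷ _) ap stuck = at-leaf ap (stuck⇒Leaf ap stuck)
        at-end (inj₁ _) (inj₁ _ ∷ _) record { linked = () ∷ _ } _

      search : ∀ fuel {v r} → ActivePath (v ∷ r) → m + n < length (v ∷ r) + fuel → Reducible
      search zero       ap bound =
        ⊥-elim (<⇒≱ (subst (m + n <_) (+-identityʳ _) bound) (Unique⇒length≤m+n (distinct ap)))
      search (suc fuel) ap bound with advance ap
      ... | inj₁ reducible = reducible
      ... | inj₂ (_ , _ , ap′ , longer) =
              search fuel ap′ (≤-trans bound (≤-trans (≤-reflexive (+-suc _ fuel)) (+-monoˡ-≤ fuel longer)))

      reducible : ∀ {x} → x ∈ A → Reducible
      reducible x∈A =
        search (m + n) {inj₁ _} {[]} record { distinct = [] ∷ [] ; linked = [-] ; active = x∈A ∷ [] } ≤-refl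

      remainingX : Reducible → Subset m
      remainingX (lonely _ _)                            = A
      remainingX (isolated {x} _ _)                      = A - x
      remainingX (twinLeaves {x} {x'} _ _ _ _ _ _ _ _)   = A - x - x'
      remainingX (pendant {x} {x₀} _ _ _ _ _ _ _ _)      = A - x - x₀

      remainingY : Reducible → Subset n
      remainingY (lonely {y} _ _)                        = B - y
      remainingY (isolated _ _)                          = B
      remainingY (twinLeaves {y = y} _ _ _ _ _ _ _ _)    = B - y
      remainingY (pendant {y = y} _ _ _ _ _ _ _ _)       = B - y

      cherry-smaller : ∀ {x x' y} → x ∈ A → ∣ A - x - x' ∣ + ∣ B - y ∣ < ∣ A ∣ + ∣ B ∣
      cherry-smaller {x} {x'} {y} x∈A =
        +-mono-<-≤ (≤-<-trans (∣p─q∣≤∣p∣ (A - x) ⁅ x' ⁆) (x∈p⇒∣p-x∣<∣p∣ x∈A)) (∣p─q∣≤∣p∣ B ⁅ y ⁆)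

      remaining-smaller : ∀ red → ∣ remainingX red ∣ + ∣ remainingY red ∣ < ∣ A ∣ + ∣ B ∣
      remaining-smaller (lonely y∈B _)                 = +-monoʳ-< ∣ A ∣ (x∈p⇒∣p-x∣<∣p∣ y∈B)
      remaining-smaller (isolated x∈A _)               = +-monoˡ-< ∣ B ∣ (x∈p⇒∣p-x∣<∣p∣ x∈A)
      remaining-smaller (twinLeaves x∈A _ _ _ _ _ _ _) = cherry-smaller x∈A
      remaining-smaller (pendant x∈A _ _ _ _ _ _ _)    = cherry-smaller x∈A

      reduce : ∀ red → BoundedCover (remainingX red) (remainingY red) → BoundedCover A B
      reduce (lonely {y} y∈B lonely′) bc = record
        { P = P ; S = S ; cover = Cover-weaken (p─q⊆p B ⁅ y ⁆) cover ; S⊆A = S⊆A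
        ; bound = ≤-trans (+-monoʳ-≤ (length P) (p⊆q⇒∣p∣≤∣q∣ (∩⊆∩ Λ⊆))) bound
        }
        where
        open BoundedCover bc
        Λ⊆ : ∀ {y'} → y' ∈ Λ G S → y' ∈ B → y' ∈ Λ G S × y' ∈ B - y
        Λ⊆ y'∈Λ y'∈B = y'∈Λ , x∈p∧x≢y⇒x∈p-y y'∈B
          λ { refl → ∉Λ {S} (λ x∈S x'∈S → lonely′ (S⊆A x∈S) (S⊆A x'∈S)) y'∈Λ }
      reduce (isolated {x} x∈A isolated′) bc = record
        { P = [ inj₁ x ] ∷ P ; S = S ∪ ⁅ x ⁆ ; cover = Cover-isolated x∈A cover
        ; S⊆A = p∪⁅x⁆⊆q (p─q⊆p A ⁅ x ⁆ ∘ S⊆A) x∈A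
        ; bound = bound-∷ 0 bound (p⊆q⇒∣p∣≤∣q∣ (∩⊆∩ Λ⊆)) (x∉p⇒∣p∣<∣p∪⁅x⁆∣ (x∉p-x ∘ S⊆A))
        }
        where
        open BoundedCover bc
        Λ⊆ : ∀ {y} → y ∈ Λ G (S ∪ ⁅ x ⁆) → y ∈ B → y ∈ Λ G S × y ∈ B
        Λ⊆ y∈Λ y∈B = ∈Λ-∪⁅⁆⁻ {S} (isolated′ y∈B) y∈Λ , y∈B
      reduce (twinLeaves {x} {x'} {y} x∈A x'∈A y∈B x≢x' gxy gx'y leaf leaf') bc = record
        { P = (inj₁ x ∷ inj₂ y ∷ inj₁ x' ∷ []) ∷ P ; S = (S ∪ ⁅ x ⁆) ∪ ⁅ x' ⁆
        ; cover = Cover-cherry x∈A x'∈A y∈B x≢x' gxy gx'y cover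
        ; S⊆A = p∪⁅x⁆⊆q (p∪⁅x⁆⊆q (p-x-y⊆p ∘ S⊆A) x∈A) x'∈A
        ; bound = bound-∷ 1 bound Λ-bound S-grows
        }
        where
        open BoundedCover bc
        Λ⊆ : Λ G ((S ∪ ⁅ x ⁆) ∪ ⁅ x' ⁆) ∩ B ⊆ ⁅ y ⁆ ∪ Λ G S ∩ (B - y)
        Λ⊆ {y'} y'∈ with x∈p∩q⁻ (Λ G ((S ∪ ⁅ x ⁆) ∪ ⁅ x' ⁆)) B y'∈ | y' ≟ᶠ y
        ... | _           | yes refl = x∈p∪q⁺ (inj₁ (x∈⁅x⁆ y))
        ... | y'∈Λ , y'∈B | no y'≢y  = x∈p∪q⁺ (inj₂ (x∈p∩q⁺
          (∈Λ-∪⁅⁆⁻ {S} (y'≢y ∘ leaf y'∈B) (∈Λ-∪⁅⁆⁻ {S ∪ ⁅ x ⁆} (y'≢y ∘ leaf' y'∈B) y'∈Λ) , x∈p∧x≢y⇒x∈p-y y'∈B y'≢y)))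
        Λ-bound : ∣ Λ G ((S ∪ ⁅ x ⁆) ∪ ⁅ x' ⁆) ∩ B ∣ ≤ 1 + ∣ Λ G S ∩ (B - y) ∣
        Λ-bound = ≤-trans (p⊆q⇒∣p∣≤∣q∣ Λ⊆)
          (subst (λ k → ∣ ⁅ y ⁆ ∪ Λ G S ∩ (B - y) ∣ ≤ k + ∣ Λ G S ∩ (B - y) ∣) (∣⁅x⁆∣≡1 y) (∣p∪q∣≤∣p∣+∣q∣ ⁅ y ⁆ _))
        x'∉S∪⁅x⁆ : x' ∉ S ∪ ⁅ x ⁆
        x'∉S∪⁅x⁆ x'∈ with x∈p∪q⁻ S ⁅ x ⁆ x'∈
        ... | inj₁ x'∈S   = x∉p-x (S⊆A x'∈S)
        ... | inj₂ x'∈⁅x⁆ = x≢x' (sym (x∈⁅y⁆⇒x≡y x x'∈⁅x⁆))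
        S-grows : 1 + ∣ S ∣ < ∣ (S ∪ ⁅ x ⁆) ∪ ⁅ x' ⁆ ∣
        S-grows = ≤-trans (s≤s (x∉p⇒∣p∣<∣p∪⁅x⁆∣ (x∉p-x ∘ p─q⊆p (A - x) ⁅ x' ⁆ ∘ S⊆A))) (x∉p⇒∣p∣<∣p∪⁅x⁆∣ x'∉S∪⁅x⁆)
      reduce (pendant {x} {x₀} {y} x∈A x₀∈A y∈B x≢x₀ gxy gx₀y leaf x-or-x₀) bc = record
        { P = (inj₁ x ∷ inj₂ y ∷ inj₁ x₀ ∷ []) ∷ P ; S = S ∪ ⁅ x ⁆
        ; cover = Cover-cherry x∈A x₀∈A y∈B x≢x₀ gxy gx₀y cover
        ; S⊆A = p∪⁅x⁆⊆q (p-x-y⊆p ∘ S⊆A) x∈A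
        ; bound = bound-∷ 0 bound (p⊆q⇒∣p∣≤∣q∣ (∩⊆∩ Λ⊆)) (x∉p⇒∣p∣<∣p∪⁅x⁆∣ (x∉p-x ∘ p─q⊆p (A - x) ⁅ x₀ ⁆ ∘ S⊆A))
        }
        where
        open BoundedCover bc
        only-x : ∀ {z} → z ∈ S ∪ ⁅ x ⁆ → G z y ≡ true → z ≡ x
        only-x z∈ gzy with x∈p∪q⁻ S ⁅ x ⁆ z∈
        ... | inj₂ z∈⁅x⁆ = x∈⁅y⁆⇒x≡y x z∈⁅x⁆
        ... | inj₁ z∈S with x-or-x₀ (p-x-y⊆p (S⊆A z∈S)) gzy
        ...   | inj₁ z≡x  = z≡x
        ...   | inj₂ refl = ⊥-elim (x∉p-x (S⊆A z∈S))
        Λ⊆ : ∀ {y'} → y' ∈ Λ G (S ∪ ⁅ x ⁆) → y' ∈ B → y' ∈ Λ G S × y' ∈ B - y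
        Λ⊆ {y'} y'∈Λ y'∈B with y' ≟ᶠ y
        ... | yes refl =
          ⊥-elim (∉Λ {S ∪ ⁅ x ⁆} (λ z∈ z'∈ gzy gz'y → trans (only-x z∈ gzy) (sym (only-x z'∈ gz'y))) y'∈Λ)
        ... | no  y'≢y = ∈Λ-∪⁅⁆⁻ {S} (y'≢y ∘ leaf y'∈B) y'∈Λ , x∈p∧x≢y⇒x∈p-y y'∈B y'≢y

    boundedCover : ∀ A B → BoundedCover A B
    boundedCover A B = go A B (<-wellFounded _)
      where
      go : ∀ A B → Acc _<_ (∣ A ∣ + ∣ B ∣) → BoundedCover A B
      go A B (acc smaller) with nonempty? A
      ... | no  A-empty   = emptyCover A-empty
      ... | yes (_ , x∈A) = reduce A B red (go _ _ (smaller (remaining-smaller A B red)))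
        where red = reducible A B x∈A

∈-allSubsets : ∀ {m} (S : Subset m) → S ∈ˡ allSubsets m
∈-allSubsets []      = here refl
∈-allSubsets (b ∷ S) = extend b (∈-allSubsets S)
  where
  extend : ∀ b {Ss} → S ∈ˡ Ss → b ∷ S ∈ˡ concatMap (λ S → (false ∷ S) ∷ (true ∷ S) ∷ []) Ss
  extend false (here refl)  = here refl
  extend true  (here refl)  = there (here refl)
  extend b     {T ∷ _} (there S∈Ss) = ∈-++⁺ʳ ((false ∷ T) ∷ (true ∷ T) ∷ []) (extend b S∈Ss)

≤-foldr-⊔ : ∀ {a} {A : Set a} (f : A → ℤ) {z x xs} → x ∈ˡ xs → f x ≤ᶻ foldr (λ y d → f y ⊔ d) z xs
≤-foldr-⊔ f (here refl)  = i≤i⊔j _ _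
≤-foldr-⊔ f (there x∈xs) = ≤ᶻ-trans (≤-foldr-⊔ f x∈xs) (i≤j⊔i _ _)

m+n≤o⇒+m≤+o-+n : ∀ {m n o} → m + n ≤ o → + m ≤ᶻ + o -ᶻ + n
m+n≤o⇒+m≤+o-+n {m} {n} {o} m+n≤o rewrite [+m]-[+n]≡m⊖n o n | ⊖-≥ (m+n≤o⇒n≤o m m+n≤o) =
  +≤+ (m+n≤o⇒m≤o∸n m m+n≤o)

proposition3 : ∀ {m n} (G : BiGraph m n) → Acyclic G →
    Σ (List (List (V m n))) (λ P → IsPathXCover G P × (+ length P) ≤ᶻ defΛ G)
proposition3 G acyclic =
  P , pathXCover , ≤ᶻ-trans (m+n≤o⇒+m≤+o-+n |P|+|ΛS|≤|S|) (≤-foldr-⊔ (defΛS G) (∈-allSubsets S))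
  where
  open BoundedCover (boundedCover G acyclic ⊤ ⊤)

  pathXCover : IsPathXCover G P
  pathXCover = record
    { paths = Cover.paths cover ; disjoint = Cover.disjoint cover ; covers = λ _ → Cover.covers cover ∈⊤ }

  |P|+|ΛS|≤|S| : length P + ∣ Λ G S ∣ ≤ ∣ S ∣
  |P|+|ΛS|≤|S| = subst (λ Λ∩⊤ → length P + ∣ Λ∩⊤ ∣ ≤ ∣ S ∣) (∩-identityʳ (Λ G S)) bound
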